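{- Let $\Gamma$ be a nonempty finite set, let $A\subseteq\Gamma$ be non-trivial (i.e. $A\ne\emptyset$ and $A\ne\Gamma$), and let $\mathcal B\subseteq\mathcal P(\Gamma)$ be a non-empty family of generators. Then $\rho(A,\mathcal B)\le D_\cap(A\mid\mathcal B)$.
   Context: A sequence $A_1,\dots,A_t$ ($t\ge1$) of subsets of $\Gamma$ generates $A$ from $\mathcal B$ if $A_t=A$ and each $A_i$ equals $X\cup Y$ or $X\cap Y$ for some (not necessarily distinct) $X,Y\in\mathcal B\cup\{A_1,\dots,A_{i-1}\}$. $D_\cap(A\mid\mathcal B)$ is the minimum number of intersection steps over all sequences generating $A$ from $\mathcal B$ ($\infty$ if none). Cover complexity: let $U=\Gamma\setminus A$. A semi-filter over $U$ is a nonempty family $\mathcal F\subseteq\mathcal P(U)$ with $\emptyset\notin\mathcal F$ such that $U_1\in\mathcal F$ and $U_1\subseteq U_2\subseteq U$ imply $U_2\in\mathcal F$. $\mathcal F$ is above $w\in\Gamma$ if for every $B\in\mathcal B$ with $w\in B$ we have $B\cap U\in\mathcal F$. $\mathcal F$ preserves a pair $(E,H)$ of subsets of $U$ if $E,H\in\mathcal F$ imply $E\cap H\in\mathcal F$; it preserves a collection $\Lambda$ if it preserves each pair. $\rho(A,\mathcal B)$ is the minimum size of a collection $\Lambda$ of pairs of subsets of $U$ such that no semi-filter over $U$ that preserves $\Lambda$ is above some $a\in A$ ($\infty$ if none exists). -}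

module Defs where

open import Data.Nat using (ℕ; zero; suc)
open import Data.Fin using (Fin)
open import Data.Fin.Subset using (Subset; _∈_; _∉_; _⊆_; _∩_; _∪_; ∁; ⊥)
open import Data.List using (List; []; _∷_; _++_; length)
import Data.List.Membership.Propositional as LM
open import Data.Product using (Σ; ∃; _×_; _,_)
open import Relation.Binary.PropositionalEquality using (_≡_)
open import Relation.Nullary using (¬_)

-- Generating sequences, kept in reverse order: 'GenSeq 𝓑 prev k' says that
-- 'prev' (= A_i, …, A_1, most recent first) is a valid sequence generated from 𝓑
-- in which k steps are (labelled as) intersection steps.
data GenSeq {n : ℕ} (𝓑 : List (Subset n)) : List (Subset n) → ℕ → Set where
  nil  : GenSeq 𝓑 [] 0
  ∪step : ∀ {prev k X Y} → GenSeq 𝓑 prev k →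
          X LM.∈ (𝓑 ++ prev) → Y LM.∈ (𝓑 ++ prev) →
          GenSeq 𝓑 ((X ∪ Y) ∷ prev) k
  ∩step : ∀ {prev k X Y} → GenSeq 𝓑 prev k →
          X LM.∈ (𝓑 ++ prev) → Y LM.∈ (𝓑 ++ prev) →
          GenSeq 𝓑 ((X ∩ Y) ∷ prev) (suc k)

-- A is generated from 𝓑 by a sequence (of length t ≥ 1, ending in A)
-- using k intersection steps.  D_∩(A | 𝓑) is the least such k (∞ if none).
GeneratesWith : ∀ {n} → List (Subset n) → Subset n → ℕ → Set
GeneratesWith 𝓑 A k = Σ (List (Subset _)) λ prev → GenSeq 𝓑 (A ∷ prev) k

record SemiFilter {n : ℕ} (U : Subset n) (F : Subset n → Set) : Set where
  field
    subsetsOfU : ∀ E → F E → E ⊆ U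
    nonempty   : ∃ λ E → F E
    noEmpty    : ¬ F ⊥
    upward     : ∀ E₁ E₂ → F E₁ → E₁ ⊆ E₂ → E₂ ⊆ U → F E₂

Above : ∀ {n} → List (Subset n) → Subset n → (Subset n → Set) → Fin n → Set
Above 𝓑 U F w = ∀ B → B LM.∈ 𝓑 → w ∈ B → F (B ∩ U)

PairsIn : ∀ {n} → Subset n → List (Subset n × Subset n) → Set
PairsIn U Λ = ∀ E H → (E , H) LM.∈ Λ → E ⊆ U × H ⊆ U

Preserves : ∀ {n} → (Subset n → Set) → List (Subset n × Subset n) → Set
Preserves F Λ = ∀ E H → (E , H) LM.∈ Λ → F E → F H → F (E ∩ H)

-- Λ witnesses the cover-complexity condition for (A, 𝓑), U = Γ ∖ A:
-- no semi-filter over U preserving Λ is above some a ∈ A.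
-- ρ(A, 𝓑) is the least length of such a Λ (∞ if none).
CoverWitness : ∀ {n} → List (Subset n) → Subset n → List (Subset n × Subset n) → Set₁
CoverWitness {n} 𝓑 A Λ =
  PairsIn (∁ A) Λ ×
  (∀ (F : Subset n → Set) → SemiFilter (∁ A) F → Preserves F Λ →
     ∀ a → a ∈ A → ¬ Above 𝓑 (∁ A) F a)

{-# OPTIONS --safe #-}
-- Let U = Γ ∖ A and record, for every intersection step X ∩ Y of a sequence
-- generating A, the pair (X ∩ U , Y ∩ U).  If a semi-filter F over U preserves
-- these pairs and is above a ∈ A, then by induction along the sequence every
-- generated set S containing a has S ∩ U ∈ F: generators by aboveness, unions by
-- upward closure, intersections by preservation of the recorded pair.  For S = A
-- this puts A ∩ U = ∅ in F, which is impossible.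
module Submission where

open import Defs
open import Data.Nat using (ℕ; suc; _≤_)
open import Data.Nat.Properties using (≤-reflexive)
open import Data.Fin using (Fin)
open import Data.Fin.Subset using (Subset; ⊥; ⊤; _∩_; _∪_; ∁; _∈_; _⊆_)
open import Data.Fin.Subset.Properties
  using (x∈p∩q⁺; x∈p∩q⁻; p∩q⊆q; p⊆p∪q; q⊆p∪q; x∈p∪q⁻; ∩-inverseʳ)
open import Data.List using (List; []; _∷_; _++_; length)
open import Data.List.Relation.Unary.All using (All; []; _∷_; head; lookup; tabulate)
open import Data.List.Relation.Unary.All.Properties using (++⁺)
import Data.List.Membership.Propositional as LM
open import Data.List.Relation.Unary.Any using (here; there)
open import Data.Product using (Σ; _×_; _,_)
open import Data.Sum using (inj₁; inj₂)
open import Relation.Binary.PropositionalEquality using (_≢_; _≡_; refl; cong; subst)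

∩-monoˡ-⊆ : ∀ {n} {p q : Subset n} (r : Subset n) → p ⊆ q → p ∩ r ⊆ q ∩ r
∩-monoˡ-⊆ {p = p} r p⊆q x∈p∩r =
  let x∈p , x∈r = x∈p∩q⁻ p r x∈p∩r in x∈p∩q⁺ (p⊆q x∈p , x∈r)

[p∩r]∩[q∩r]⊆[p∩q]∩r : ∀ {n} (p q r : Subset n) → (p ∩ r) ∩ (q ∩ r) ⊆ (p ∩ q) ∩ r
[p∩r]∩[q∩r]⊆[p∩q]∩r p q r x∈ =
  let x∈p∩r , x∈q∩r = x∈p∩q⁻ (p ∩ r) (q ∩ r) x∈
      x∈p , x∈r = x∈p∩q⁻ p r x∈p∩r
      x∈q , _   = x∈p∩q⁻ q r x∈q∩r
  in x∈p∩q⁺ (x∈p∩q⁺ (x∈p , x∈q) , x∈r)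

module _ {n} {𝓑 : List (Subset n)} (U : Subset n) where

  intersectionPairs : ∀ {prev k} → GenSeq 𝓑 prev k → List (Subset n × Subset n)
  intersectionPairs nil                             = []
  intersectionPairs (∪step s _ _)                   = intersectionPairs s
  intersectionPairs (∩step {X = X} {Y = Y} s _ _) = (X ∩ U , Y ∩ U) ∷ intersectionPairs s

  length-intersectionPairs : ∀ {prev k} (s : GenSeq 𝓑 prev k) →
                             length (intersectionPairs s) ≡ k
  length-intersectionPairs nil           = refl
  length-intersectionPairs (∪step s _ _) = length-intersectionPairs s
  length-intersectionPairs (∩step s _ _) = cong suc (length-intersectionPairs s)

  intersectionPairs-in : ∀ {prev k} (s : GenSeq 𝓑 prev k) → PairsIn U (intersectionPairs s)
  intersectionPairs-in (∪step s _ _) = intersectionPairs-in s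
  intersectionPairs-in (∩step {X = X} {Y = Y} s _ _) _ _ (here refl) = p∩q⊆q X U , p∩q⊆q Y U
  intersectionPairs-in (∩step s _ _) E H (there p∈) = intersectionPairs-in s E H p∈

module _ {n} {𝓑 : List (Subset n)} {U : Subset n} {F : Subset n → Set} (SF : SemiFilter U F)
         {a : Fin n} (above : Above 𝓑 U F a) where
  open SemiFilter SF

  TraceInF : Subset n → Set
  TraceInF S = a ∈ S → F (S ∩ U)

  upward-trace : ∀ {E S} → F E → E ⊆ S ∩ U → F (S ∩ U)
  upward-trace {S = S} FE E⊆ = upward _ _ FE E⊆ (p∩q⊆q S U)

  ∪-traceInF : ∀ {X Y} → TraceInF X → TraceInF Y → TraceInF (X ∪ Y)
  ∪-traceInF {X} {Y} tX tY a∈X∪Y with x∈p∪q⁻ X Y a∈X∪Y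
  ... | inj₁ a∈X = upward-trace (tX a∈X) (∩-monoˡ-⊆ U (p⊆p∪q Y))
  ... | inj₂ a∈Y = upward-trace (tY a∈Y) (∩-monoˡ-⊆ U (q⊆p∪q X Y))

  ∩-traceInF : ∀ {X Y} → (F (X ∩ U) → F (Y ∩ U) → F ((X ∩ U) ∩ (Y ∩ U))) →
               TraceInF X → TraceInF Y → TraceInF (X ∩ Y)
  ∩-traceInF {X} {Y} preserved tX tY a∈X∩Y =
    let a∈X , a∈Y = x∈p∩q⁻ X Y a∈X∩Y
    in upward-trace (preserved (tX a∈X) (tY a∈Y)) ([p∩r]∩[q∩r]⊆[p∩q]∩r X Y U)

  available-traceInF : ∀ {prev} → All TraceInF prev → ∀ {S} → S LM.∈ 𝓑 ++ prev → TraceInF S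
  available-traceInF tprev = lookup (++⁺ (tabulate (λ {B} → above B)) tprev)

  generated-traceInF : ∀ {prev k} (s : GenSeq 𝓑 prev k) →
                       Preserves F (intersectionPairs U s) → All TraceInF prev
  generated-traceInF nil _ = []
  generated-traceInF (∪step s X∈ Y∈) P =
    ∪-traceInF (available-traceInF rest X∈) (available-traceInF rest Y∈) ∷ rest
    where rest = generated-traceInF s P
  generated-traceInF (∩step s X∈ Y∈) P =
    ∩-traceInF (P _ _ (here refl)) (available-traceInF rest X∈) (available-traceInF rest Y∈) ∷ rest
    where rest = generated-traceInF s (λ E H p∈ → P E H (there p∈))

intersectionPairs-coverWitness : ∀ {n} {𝓑 : List (Subset n)} {A prev k}
  (s : GenSeq 𝓑 (A ∷ prev) k) → CoverWitness 𝓑 A (intersectionPairs (∁ A) s)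
intersectionPairs-coverWitness {A = A} s =
  intersectionPairs-in (∁ A) s ,
  λ F SF P a a∈A above →
    let A∩∁A∈F = head (generated-traceInF SF above s P) a∈A
    in SemiFilter.noEmpty SF (subst F (∩-inverseʳ A) A∩∁A∈F)

theorem3p5 : (m : ℕ) (A : Subset (suc m)) (𝓑 : List (Subset (suc m))) →
    A ≢ ⊥ → A ≢ ⊤ → 𝓑 ≢ [] →
    (k : ℕ) → GeneratesWith 𝓑 A k →
    Σ (List (Subset (suc m) × Subset (suc m))) λ Λ → length Λ ≤ k × CoverWitness 𝓑 A Λ
theorem3p5 m A 𝓑 _ _ _ k (_ , s) =
  intersectionPairs (∁ A) s ,
  ≤-reflexive (length-intersectionPairs (∁ A) s) ,
  intersectionPairs-coverWitness s
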